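{- Let $n$ be a positive integer and $k$ an integer with $2^{k-1}<n\le 2^k$. Let $\beta=\frac{\log 2}{2\log 3}$. Then $$\beta(k-2)\le \frac{S(n)}{n}\le k.$$
   Context: Let $\varphi$ be Euler's totient function. The height function $H$ on positive integers is defined by $H(1)=0$ and $H(n)=H(\varphi(n))+1$ for $n\ge 2$. Let $S(n)=\sum_{k=1}^n H(k)$. -}

module Defs where

open import Data.Nat using (ℕ; zero; suc; _+_; _≤?_)
open import Data.Nat.GCD using (gcd)
open import Data.Nat.Properties using (_≟_)
open import Data.List using (List; filter; length; map)
open import Data.Nat.ListAction using (sum)
open import Data.List using (upTo)
open import Relation.Nullary using (yes; no)

range1 : ℕ → List ℕ
range1 n = map suc (upTo n)

φ : ℕ → ℕ
φ n = length (filter (λ k → gcd k n ≟ 1) (range1 n))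

-- H with fuel; for n ≥ 2, φ n < n, so fuel n suffices.
Hfuel : ℕ → ℕ → ℕ
Hfuel zero    n = 0
Hfuel (suc f) n with n ≤? 1
... | yes _ = 0
... | no  _ = suc (Hfuel f (φ n))

-- H(1) = 0, H(n) = H(φ n) + 1 for n ≥ 2  (H 0 = 0 is an irrelevant convention)
H : ℕ → ℕ
H n = Hfuel n n

S : ℕ → ℕ
S n = sum (map H (range1 n))

-- Shapiro's function C(n) = H(n) - [n odd] counts the even numbers in the chain
-- n, φ(n), φ(φ(n)), …, 1, because φ(m) is even for m ≥ 3; hence C(n) = C(φ(n)) + [2 ∣ n].
-- Together with φ(p m) = p φ(m) for p ∣ m and φ(p m) = (p - 1) φ(m) for a prime p ∤ m,
-- this makes C completely additive (induction over the primes). As C(2) = 1 and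
-- C(p) = C(p - 1) for odd primes p, it follows that 2 ^ C(n) ≤ n ≤ 3 ^ C(n). The first
-- inequality gives H(x) ≤ k for x ≤ 2 ^ k, hence S(n) ≤ k n. The second, applied to the
-- pairs x, n + 1 - x with n ≤ x (n + 1 - x), gives n ^ n ≤ 9 ^ S(n), and n ≥ 2 ^ (k - 1).
module Submission where

open import Defs
open import Data.List using ([]; _∷_; _∷ʳ_; filter; length; map; upTo; applyUpTo)
open import Data.List.Properties using (map-upTo; applyUpTo-∷ʳ; map-++)
open import Data.List.Relation.Unary.All using (_∷_)
open import Data.Nat
  using (ℕ; zero; suc; _+_; _*_; _∸_; _^_; _≤_; _<_; _≤?_; z≤n; s≤s; s≤s⁻¹;
         NonZero; >-nonZero; nonTrivial⇒≢1; nonTrivial⇒n>1; nonTrivial⇒nonZero)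
open import Data.Nat.Coprimality
  using (Coprime; coprime?; coprime-+; coprime-divisor; gcd≡1⇒coprime; coprime⇒gcd≡1; 1-coprimeTo)
  renaming (sym to coprime-sym)
open import Data.Nat.Divisibility
open import Data.Nat.GCD using (gcd)
open import Data.Nat.Induction using (<-rec)
open import Data.Nat.ListAction using (sum; product)
open import Data.Nat.ListAction.Properties using (sum-++)
open import Data.Nat.Primality
  using (Prime; prime?; prime⇒irreducible; prime⇒nonTrivial; prime⇒nonZero; prime[2];
         euclidsLemma; ¬prime⇒composite; composite)
open import Data.Nat.Primality.Factorisation using (factorise)
open import Data.Nat.Properties
open import Algebra.Properties.CommutativeSemigroup +-commutativeSemigroup using (interchange)
open import Data.Product using (∃-syntax; _×_; _,_)
open import Data.Sum using (_⊎_; inj₁; inj₂)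
open import Function.Base using (_∘′_)
open import Function.Bundles using (_⇔_; Equivalence; mk⇔)
open import Relation.Binary.PropositionalEquality
open import Relation.Nullary using (Dec; yes; no; ¬_; contradiction)
open import Relation.Unary using (Decidable)

-- Iverson brackets and finite sums

𝟙 : ∀ {a} {A : Set a} → Dec A → ℕ
𝟙 (yes _) = 1
𝟙 (no _)  = 0

module _ {a} {A : Set a} where

  𝟙-yes : (d : Dec A) → A → 𝟙 d ≡ 1
  𝟙-yes (yes _) _ = refl
  𝟙-yes (no ¬a) a = contradiction a ¬a

  𝟙-no : (d : Dec A) → ¬ A → 𝟙 d ≡ 0
  𝟙-no (yes a) ¬a = contradiction a ¬a
  𝟙-no (no _)  _  = refl

  𝟙≤1 : (d : Dec A) → 𝟙 d ≤ 1
  𝟙≤1 (yes _) = ≤-refl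
  𝟙≤1 (no _)  = z≤n

𝟙-cong : ∀ {a b} {A : Set a} {B : Set b} → A ⇔ B → (d : Dec A) (e : Dec B) → 𝟙 d ≡ 𝟙 e
𝟙-cong A⇔B (yes a) e = sym (𝟙-yes e (Equivalence.to A⇔B a))
𝟙-cong A⇔B (no ¬a) e = sym (𝟙-no e (¬a ∘′ Equivalence.from A⇔B))

-- The index runs over 1 ≤ x ≤ n (not 0 ≤ x < n), as in range1.
∑ : ℕ → (ℕ → ℕ) → ℕ
∑ zero    f = 0
∑ (suc n) f = ∑ n f + f (suc n)

∑-cong : ∀ {f g} n → f ≗ g → ∑ n f ≡ ∑ n g
∑-cong zero    f≗g = refl
∑-cong (suc n) f≗g = cong₂ _+_ (∑-cong n f≗g) (f≗g (suc n))

∑-distrib-+ : ∀ {f g} n → ∑ n (λ x → f x + g x) ≡ ∑ n f + ∑ n g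
∑-distrib-+         zero    = refl
∑-distrib-+ {f} {g} (suc n) = begin
  ∑ n (λ x → f x + g x) + (f (suc n) + g (suc n)) ≡⟨ cong (_+ (f (suc n) + g (suc n))) (∑-distrib-+ n) ⟩
  ∑ n f + ∑ n g + (f (suc n) + g (suc n))         ≡⟨ interchange (∑ n f) (∑ n g) _ _ ⟩
  ∑ n f + f (suc n) + (∑ n g + g (suc n))         ∎
  where open ≡-Reasoning

∑-+ : ∀ {f} m n → ∑ (m + n) f ≡ ∑ m f + ∑ n (λ x → f (m + x))
∑-+ {f} m zero    = trans (cong (λ k → ∑ k f) (+-identityʳ m)) (sym (+-identityʳ (∑ m f)))
∑-+ {f} m (suc n) = begin
  ∑ (m + suc n) f                                   ≡⟨ cong (λ k → ∑ k f) (+-suc m n) ⟩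
  ∑ (m + n) f + f (suc (m + n))                     ≡⟨ cong₂ _+_ (∑-+ m n) (cong f (sym (+-suc m n))) ⟩
  ∑ m f + ∑ n (λ x → f (m + x)) + f (m + suc n)     ≡⟨ +-assoc (∑ m f) _ _ ⟩
  ∑ m f + (∑ n (λ x → f (m + x)) + f (m + suc n))   ∎
  where open ≡-Reasoning

∑-suc : ∀ {f} n → ∑ (suc n) f ≡ f 1 + ∑ n (λ x → f (suc x))
∑-suc = ∑-+ 1

∑-reverse : ∀ {f} n → ∑ n f ≡ ∑ n (λ x → f (suc n ∸ x))
∑-reverse     zero    = refl
∑-reverse {f} (suc n) = begin
  ∑ n f + f (suc n)                       ≡⟨ +-comm (∑ n f) _ ⟩
  f (suc n) + ∑ n f                       ≡⟨ cong (f (suc n) +_) (∑-reverse n) ⟩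
  f (suc n) + ∑ n (λ x → f (suc n ∸ x))   ≡⟨ sym (∑-suc n) ⟩
  ∑ (suc n) (λ x → f (suc (suc n) ∸ x))   ∎
  where open ≡-Reasoning

∑-periodic : ∀ {f} m → (∀ x → f (m + x) ≡ f x) → ∀ j → ∑ (j * m) f ≡ j * ∑ m f
∑-periodic     m f-periodic zero    = refl
∑-periodic {f} m f-periodic (suc j) = begin
  ∑ (m + j * m) f                       ≡⟨ ∑-+ m (j * m) ⟩
  ∑ m f + ∑ (j * m) (λ x → f (m + x))   ≡⟨ cong (∑ m f +_) (∑-cong (j * m) f-periodic) ⟩
  ∑ m f + ∑ (j * m) f                   ≡⟨ cong (∑ m f +_) (∑-periodic m f-periodic j) ⟩
  ∑ m f + j * ∑ m f                     ∎
  where open ≡-Reasoning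

∑-≤ : ∀ {f} n {c} → (∀ {x} → 1 ≤ x → x ≤ n → f x ≤ c) → ∑ n f ≤ n * c
∑-≤     zero    _   = z≤n
∑-≤ {f} (suc n) {c} f≤c = begin
  ∑ n f + f (suc n)  ≤⟨ +-mono-≤ (∑-≤ n (λ 1≤x x≤n → f≤c 1≤x (m≤n⇒m≤1+n x≤n))) (f≤c (s≤s z≤n) ≤-refl) ⟩
  n * c + c          ≡⟨ +-comm (n * c) c ⟩
  c + n * c          ∎
  where open ≤-Reasoning

term≤∑ : ∀ {f} n {x} → 1 ≤ x → x ≤ n → f x ≤ ∑ n f
term≤∑ zero (s≤s _) ()
term≤∑ {f} (suc n) 1≤x x≤1+n with m≤n⇒m<n∨m≡n x≤1+n
... | inj₁ x≤n  = ≤-trans (term≤∑ n 1≤x (s≤s⁻¹ x≤n)) (m≤m+n (∑ n f) _)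
... | inj₂ refl = m≤n+m (f (suc n)) (∑ n f)

∑-power : ∀ {f} a {b} n → (∀ {x} → 1 ≤ x → x ≤ n → b ≤ a ^ f x) → b ^ n ≤ a ^ ∑ n f
∑-power     a     zero    _  = ≤-refl
∑-power {f} a {b} (suc n) b≤ = begin
  b * b ^ n                   ≤⟨ *-mono-≤ (b≤ (s≤s z≤n) ≤-refl) (∑-power a n (λ 1≤x x≤n → b≤ 1≤x (m≤n⇒m≤1+n x≤n))) ⟩
  a ^ f (suc n) * a ^ ∑ n f   ≡⟨ *-comm (a ^ f (suc n)) _ ⟩
  a ^ ∑ n f * a ^ f (suc n)   ≡⟨ sym (^-distribˡ-+-* a (∑ n f) (f (suc n))) ⟩
  a ^ (∑ n f + f (suc n))     ∎
  where open ≤-Reasoning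

∑-multiples : ∀ p .{{_ : NonZero p}} (f : ℕ → ℕ) j →
              ∑ (j * p) (λ x → 𝟙 (p ∣? x) * f x) ≡ ∑ j (λ i → f (i * p))
∑-multiples p         f zero    = refl
∑-multiples p@(suc q) f (suc j) = begin
  ∑ (p + j * p) g                                        ≡⟨ ∑-+ p (j * p) ⟩
  ∑ p g + ∑ (j * p) (λ x → g (p + x))                    ≡⟨ cong₂ _+_ first-block (∑-cong (j * p) shift) ⟩
  f (1 * p) + ∑ (j * p) (λ x → 𝟙 (p ∣? x) * f (p + x))   ≡⟨ cong (f (1 * p) +_) (∑-multiples p (λ x → f (p + x)) j) ⟩
  f (1 * p) + ∑ j (λ i → f (suc i * p))                  ≡⟨ sym (∑-suc j) ⟩
  ∑ (suc j) (λ i → f (i * p))                            ∎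
  where
  open ≡-Reasoning
  g : ℕ → ℕ
  g x = 𝟙 (p ∣? x) * f x
  shift : ∀ x → g (p + x) ≡ 𝟙 (p ∣? x) * f (p + x)
  shift x = cong (_* f (p + x))
    (𝟙-cong (mk⇔ (λ p∣p+x → ∣m+n∣m⇒∣n p∣p+x ∣-refl) (∣m∣n⇒∣m+n ∣-refl)) (p ∣? (p + x)) (p ∣? x))
  g≤0 : ∀ {x} → 1 ≤ x → x ≤ q → g x ≤ 0
  g≤0 {x} 1≤x x≤q = ≤-reflexive (cong (_* f x) (𝟙-no (p ∣? x) (>⇒∤ {{>-nonZero 1≤x}} (s≤s x≤q))))
  first-block : ∑ p g ≡ f (1 * p)
  first-block = begin
    ∑ q g + g p   ≡⟨ cong₂ _+_ (n≤0⇒n≡0 (subst (∑ q g ≤_) (*-zeroʳ q) (∑-≤ q g≤0)))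
                               (cong (_* f p) (𝟙-yes (p ∣? p) ∣-refl)) ⟩
    0 + 1 * f p   ≡⟨ +-identityʳ (f p) ⟩
    f p           ≡⟨ cong f (sym (+-identityʳ p)) ⟩
    f (1 * p)     ∎

range1-suc : ∀ n → range1 (suc n) ≡ range1 n ∷ʳ suc n
range1-suc n = begin
  map suc (upTo (suc n))     ≡⟨ map-upTo suc (suc n) ⟩
  applyUpTo suc (suc n)      ≡⟨ sym (applyUpTo-∷ʳ suc n) ⟩
  applyUpTo suc n ∷ʳ suc n   ≡⟨ cong (_∷ʳ suc n) (sym (map-upTo suc n)) ⟩
  range1 n ∷ʳ suc n          ∎
  where open ≡-Reasoning

sum-map-range1 : ∀ f n → sum (map f (range1 n)) ≡ ∑ n f
sum-map-range1 f zero    = refl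
sum-map-range1 f (suc n) = begin
  sum (map f (range1 (suc n)))               ≡⟨ cong (sum ∘′ map f) (range1-suc n) ⟩
  sum (map f (range1 n ∷ʳ suc n))            ≡⟨ cong sum (map-++ f (range1 n) _) ⟩
  sum (map f (range1 n) ∷ʳ f (suc n))        ≡⟨ sum-++ (map f (range1 n)) _ ⟩
  sum (map f (range1 n)) + (f (suc n) + 0)   ≡⟨ cong₂ _+_ (sum-map-range1 f n) (+-identityʳ (f (suc n))) ⟩
  ∑ n f + f (suc n)                          ∎
  where open ≡-Reasoning

length-filter : ∀ {a p} {A : Set a} {P : A → Set p} (P? : Decidable P) xs →
                length (filter P? xs) ≡ sum (map (λ x → 𝟙 (P? x)) xs)
length-filter P? []       = refl
length-filter P? (x ∷ xs) with P? x
... | yes _ = cong suc (length-filter P? xs)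
... | no _  = length-filter P? xs

-- Divisibility, coprimality and primes

coprime-∣ˡ : ∀ {x m d} → Coprime x m → d ∣ x → Coprime d m
coprime-∣ˡ x⊥m d∣x (e∣d , e∣m) = x⊥m (∣-trans e∣d d∣x , e∣m)

coprime-∣ʳ : ∀ {x m d} → Coprime x m → d ∣ m → Coprime x d
coprime-∣ʳ x⊥m d∣m (e∣x , e∣d) = x⊥m (e∣x , ∣-trans e∣d d∣m)

coprime-*ʳ : ∀ {x a b} → Coprime x a → Coprime x b → Coprime x (a * b)
coprime-*ʳ x⊥a x⊥b (d∣x , d∣ab) = x⊥b (d∣x , coprime-divisor (coprime-∣ˡ x⊥a d∣x) d∣ab)

coprime-+⁻¹ : ∀ {m n} → Coprime (n + m) n → Coprime m n
coprime-+⁻¹ n+m⊥n (d∣m , d∣n) = n+m⊥n (∣m∣n⇒∣m+n d∣n d∣m , d∣n)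

prime∤⇒coprime : ∀ {p x} → Prime p → ¬ p ∣ x → Coprime p x
prime∤⇒coprime p-prime p∤x (d∣p , d∣x) with prime⇒irreducible p-prime d∣p
... | inj₁ d≡1  = d≡1
... | inj₂ refl = contradiction d∣x p∤x

prime⇒1<p : ∀ {p} → Prime p → 1 < p
prime⇒1<p {p} p-prime = nonTrivial⇒n>1 p {{prime⇒nonTrivial p-prime}}

prime∤1 : ∀ {p} → Prime p → ¬ p ∣ 1
prime∤1 p-prime p∣1 = nonTrivial⇒≢1 {{prime⇒nonTrivial p-prime}} (∣1⇒≡1 p∣1)

prime∧2∣⇒≡2 : ∀ {p} → Prime p → 2 ∣ p → p ≡ 2
prime∧2∣⇒≡2 p-prime 2∣p with prime⇒irreducible p-prime 2∣p
... | inj₂ 2≡p = sym 2≡p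

prime∧2∤⇒2<p : ∀ {p} → Prime p → ¬ 2 ∣ p → 2 < p
prime∧2∤⇒2<p p-prime 2∤p with m≤n⇒m<n∨m≡n (prime⇒1<p p-prime)
... | inj₁ 2<p  = 2<p
... | inj₂ refl = contradiction ∣-refl 2∤p

prime-factor : ∀ n → 1 < n → ∃[ p ] ∃[ m ] Prime p × n ≡ p * m
prime-factor 1               (s≤s ())
prime-factor n@(suc (suc _)) _ with factorise n
... | record { factors = p ∷ ps ; isFactorisation = n≡p*ps ; factorsPrime = p-prime ∷ _ } =
  p , product ps , p-prime , n≡p*ps

module _ {ℓ} {P : ℕ → Set ℓ} (P[1] : P 1)
         (P[p] : ∀ {p} → Prime p → (∀ {m} → .{{NonZero m}} → m < p → P m) → P p)
         (P[*] : ∀ {a b} → .{{NonZero a}} → .{{NonZero b}} → P a → P b → P (a * b))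
         where

  prime-induction : ∀ n → .{{NonZero n}} → P n
  prime-induction = <-rec (λ n → .{{NonZero n}} → P n) step
    where
    step : ∀ n → (∀ {m} → m < n → .{{NonZero m}} → P m) → .{{NonZero n}} → P n
    step 1               _   = P[1]
    step n@(suc (suc _)) rec with prime? n
    ... | yes n-prime = P[p] n-prime (λ m<n → rec m<n)
    ... | no ¬n-prime with ¬prime⇒composite ¬n-prime
    ...   | composite {d} d<n d∣n = subst P (sym (m∣n⇒n≡quotient*m d∣n))
              (P[*] {{quotient≢0 d∣n}} {{nonTrivial⇒nonZero d}}
                (rec (quotient-< d∣n) {{quotient≢0 d∣n}}) (rec d<n {{nonTrivial⇒nonZero d}}))

2∣n⊎2∣1+n : ∀ n → 2 ∣ n ⊎ 2 ∣ suc n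
2∣n⊎2∣1+n zero    = inj₁ (2 ∣0)
2∣n⊎2∣1+n (suc n) with 2∣n⊎2∣1+n n
... | inj₁ 2∣n   = inj₂ (∣m∣n⇒∣m+n ∣-refl 2∣n)
... | inj₂ 2∣1+n = inj₁ 2∣1+n

2∤n⇒2∣n∸1 : ∀ {n} → ¬ 2 ∣ n → 2 ∣ n ∸ 1
2∤n⇒2∣n∸1 {zero}  2∤0 = contradiction (2 ∣0) 2∤0
2∤n⇒2∣n∸1 {suc n} 2∤n with 2∣n⊎2∣1+n n
... | inj₁ 2∣n   = 2∣n
... | inj₂ 2∣1+n = contradiction 2∣1+n 2∤n

2∤n∧n≢1⇒2<n : ∀ {n} → .{{_ : NonZero n}} → ¬ 2 ∣ n → n ≢ 1 → 2 < n
2∤n∧n≢1⇒2<n {1}                 _   n≢1 = contradiction refl n≢1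
2∤n∧n≢1⇒2<n {2}                 2∤2 _   = contradiction ∣-refl 2∤2
2∤n∧n≢1⇒2<n {suc (suc (suc _))} _   _   = s≤s (s≤s (s≤s z≤n))

2∤2^k⇒2^k≡1 : ∀ k → ¬ 2 ∣ 2 ^ k → 2 ^ k ≡ 1
2∤2^k⇒2^k≡1 zero    _     = refl
2∤2^k⇒2^k≡1 (suc k) 2∤2^k = contradiction (m∣m*n (2 ^ k)) 2∤2^k

𝟙-2∣-*-∣ : ∀ {a b} → a ∣ b → 𝟙 (2 ∣? (a * b)) ≡ 𝟙 (2 ∣? b)
𝟙-2∣-*-∣ {a} {b} a∣b = 𝟙-cong (mk⇔ to (∣n⇒∣m*n a)) (2 ∣? (a * b)) (2 ∣? b)
  where
  to : 2 ∣ a * b → 2 ∣ b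
  to 2∣ab with euclidsLemma a b prime[2] 2∣ab
  ... | inj₁ 2∣a = ∣-trans 2∣a a∣b
  ... | inj₂ 2∣b = 2∣b

𝟙-2∣-* : ∀ {a b} → (2 ∣ a → ¬ 2 ∣ b) → 𝟙 (2 ∣? (a * b)) ≡ 𝟙 (2 ∣? a) + 𝟙 (2 ∣? b)
𝟙-2∣-* {a} {b} ¬both with 2 ∣? a
... | yes 2∣a = trans (𝟙-yes (2 ∣? (a * b)) (∣m⇒∣m*n b 2∣a)) (cong suc (sym (𝟙-no (2 ∣? b) (¬both 2∣a))))
... | no  2∤a = 𝟙-cong (mk⇔ to (∣n⇒∣m*n a)) (2 ∣? (a * b)) (2 ∣? b)
  where
  to : 2 ∣ a * b → 2 ∣ b
  to 2∣ab with euclidsLemma a b prime[2] 2∣ab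
  ... | inj₁ 2∣a = contradiction 2∣a 2∤a
  ... | inj₂ 2∣b = 2∣b

-- Euler's totient

φ-∑ : ∀ n → φ n ≡ ∑ n (λ x → 𝟙 (coprime? x n))
φ-∑ n = begin
  length (filter (λ x → gcd x n ≟ 1) (range1 n))   ≡⟨ length-filter (λ x → gcd x n ≟ 1) (range1 n) ⟩
  sum (map (λ x → 𝟙 (gcd x n ≟ 1)) (range1 n))     ≡⟨ sum-map-range1 _ n ⟩
  ∑ n (λ x → 𝟙 (gcd x n ≟ 1))                      ≡⟨ ∑-cong n (λ x → 𝟙-cong (mk⇔ gcd≡1⇒coprime coprime⇒gcd≡1) _ _) ⟩
  ∑ n (λ x → 𝟙 (coprime? x n))                     ∎
  where open ≡-Reasoning

φ<n : ∀ {n} → 1 < n → φ n < n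
φ<n {suc m} 1<n = begin-strict
  φ (suc m)           ≡⟨ φ-∑ (suc m) ⟩
  ∑ m f + f (suc m)   ≡⟨ cong (∑ m f +_) (𝟙-no (coprime? (suc m) (suc m)) ¬n⊥n) ⟩
  ∑ m f + 0           ≤⟨ +-monoˡ-≤ 0 (∑-≤ m (λ _ _ → 𝟙≤1 _)) ⟩
  m * 1 + 0           ≡⟨ trans (+-identityʳ (m * 1)) (*-identityʳ m) ⟩
  m                   <⟨ n<1+n m ⟩
  suc m               ∎
  where
  open ≤-Reasoning
  f : ℕ → ℕ
  f x = 𝟙 (coprime? x (suc m))
  ¬n⊥n : ¬ Coprime (suc m) (suc m)
  ¬n⊥n n⊥n = <⇒≢ 1<n (sym (n⊥n (∣-refl , ∣-refl)))

φ-nonZero : ∀ n .{{_ : NonZero n}} → NonZero (φ n)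
φ-nonZero n@(suc _) = >-nonZero (begin
  1                              ≡⟨ sym (𝟙-yes (coprime? 1 n) (1-coprimeTo n)) ⟩
  𝟙 (coprime? 1 n)               ≤⟨ term≤∑ n (s≤s z≤n) (s≤s z≤n) ⟩
  ∑ n (λ x → 𝟙 (coprime? x n))   ≡⟨ sym (φ-∑ n) ⟩
  φ n                            ∎)
  where open ≤-Reasoning

∑-coprime : ∀ m j → ∑ (j * m) (λ x → 𝟙 (coprime? x m)) ≡ j * φ m
∑-coprime m j = begin
  ∑ (j * m) (λ x → 𝟙 (coprime? x m))   ≡⟨ ∑-periodic m (λ x → 𝟙-cong (mk⇔ coprime-+⁻¹ coprime-+) _ _) j ⟩
  j * ∑ m (λ x → 𝟙 (coprime? x m))     ≡⟨ cong (j *_) (sym (φ-∑ m)) ⟩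
  j * φ m                               ∎
  where open ≡-Reasoning

∑-multiples-coprime : ∀ {p m} .{{_ : NonZero p}} → Coprime p m →
                      ∑ (p * m) (λ x → 𝟙 (p ∣? x) * 𝟙 (coprime? x m)) ≡ φ m
∑-multiples-coprime {p} {m} p⊥m = begin
  ∑ (p * m) (λ x → 𝟙 (p ∣? x) * 𝟙 (coprime? x m))   ≡⟨ cong (λ k → ∑ k (λ x → 𝟙 (p ∣? x) * 𝟙 (coprime? x m))) (*-comm p m) ⟩
  ∑ (m * p) (λ x → 𝟙 (p ∣? x) * 𝟙 (coprime? x m))   ≡⟨ ∑-multiples p (λ x → 𝟙 (coprime? x m)) m ⟩
  ∑ m (λ i → 𝟙 (coprime? (i * p) m))                ≡⟨ ∑-cong m (λ i → 𝟙-cong ip⊥m⇔i⊥m _ _) ⟩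
  ∑ m (λ i → 𝟙 (coprime? i m))                      ≡⟨ sym (φ-∑ m) ⟩
  φ m                                               ∎
  where
  open ≡-Reasoning
  ip⊥m⇔i⊥m : ∀ {i} → Coprime (i * p) m ⇔ Coprime i m
  ip⊥m⇔i⊥m {i} = mk⇔ to from
    where
    to : Coprime (i * p) m → Coprime i m
    to ip⊥m = coprime-∣ˡ ip⊥m (m∣m*n p)
    from : Coprime i m → Coprime (i * p) m
    from i⊥m = coprime-sym (coprime-*ʳ (coprime-sym i⊥m) (coprime-sym p⊥m))

φ-*-∣ : ∀ p m → p ∣ m → φ (p * m) ≡ p * φ m
φ-*-∣ p m p∣m = begin
  φ (p * m)                                  ≡⟨ φ-∑ (p * m) ⟩
  ∑ (p * m) (λ x → 𝟙 (coprime? x (p * m)))   ≡⟨ ∑-cong (p * m) (λ x → 𝟙-cong x⊥pm⇔x⊥m _ _) ⟩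
  ∑ (p * m) (λ x → 𝟙 (coprime? x m))         ≡⟨ ∑-coprime m p ⟩
  p * φ m                                    ∎
  where
  open ≡-Reasoning
  x⊥pm⇔x⊥m : ∀ {x} → Coprime x (p * m) ⇔ Coprime x m
  x⊥pm⇔x⊥m {x} = mk⇔ to from
    where
    to : Coprime x (p * m) → Coprime x m
    to x⊥pm = coprime-∣ʳ x⊥pm (n∣m*n p)
    from : Coprime x m → Coprime x (p * m)
    from x⊥m = coprime-*ʳ (coprime-∣ʳ x⊥m p∣m) x⊥m

-- Among 1, …, p m, the numbers coprime to m are those coprime to p m together with
-- the multiples of p coprime to m.
φ[p*m]+φ[m]≡p*φ[m] : ∀ {p m} → Prime p → ¬ p ∣ m → φ (p * m) + φ m ≡ p * φ m
φ[p*m]+φ[m]≡p*φ[m] {p} {m} p-prime p∤m = begin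
  φ (p * m) + φ m
    ≡⟨ cong₂ _+_ (φ-∑ (p * m)) (sym (∑-multiples-coprime (prime∤⇒coprime p-prime p∤m))) ⟩
  ∑ (p * m) (λ x → 𝟙 (coprime? x (p * m))) + ∑ (p * m) (λ x → 𝟙 (p ∣? x) * 𝟙 (coprime? x m))
    ≡⟨ sym (∑-distrib-+ (p * m)) ⟩
  ∑ (p * m) (λ x → 𝟙 (coprime? x (p * m)) + 𝟙 (p ∣? x) * 𝟙 (coprime? x m))
    ≡⟨ ∑-cong (p * m) split ⟩
  ∑ (p * m) (λ x → 𝟙 (coprime? x m))
    ≡⟨ ∑-coprime m p ⟩
  p * φ m
    ∎
  where
  open ≡-Reasoning
  instance _ = prime⇒nonZero p-prime
  split : ∀ x → 𝟙 (coprime? x (p * m)) + 𝟙 (p ∣? x) * 𝟙 (coprime? x m) ≡ 𝟙 (coprime? x m)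
  split x with p ∣? x
  ... | yes p∣x = cong₂ _+_ (𝟙-no (coprime? x (p * m)) ¬x⊥pm) (+-identityʳ (𝟙 (coprime? x m)))
    where
    ¬x⊥pm : ¬ Coprime x (p * m)
    ¬x⊥pm x⊥pm = nonTrivial⇒≢1 {{prime⇒nonTrivial p-prime}} (x⊥pm (p∣x , m∣m*n m))
  ... | no p∤x  = trans (+-identityʳ (𝟙 (coprime? x (p * m)))) (𝟙-cong (mk⇔ to from) _ _)
    where
    to : Coprime x (p * m) → Coprime x m
    to x⊥pm = coprime-∣ʳ x⊥pm (n∣m*n p)
    from : Coprime x m → Coprime x (p * m)
    from = coprime-*ʳ (coprime-sym (prime∤⇒coprime p-prime p∤x))

φ-*-∤ : ∀ {p m} → Prime p → ¬ p ∣ m → φ (p * m) ≡ (p ∸ 1) * φ m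
φ-*-∤ {p} {m} p-prime p∤m = begin
  φ (p * m)               ≡⟨ sym (m+n∸n≡m (φ (p * m)) (φ m)) ⟩
  φ (p * m) + φ m ∸ φ m   ≡⟨ cong (_∸ φ m) (φ[p*m]+φ[m]≡p*φ[m] p-prime p∤m) ⟩
  p * φ m ∸ φ m           ≡⟨ cong (p * φ m ∸_) (sym (*-identityˡ (φ m))) ⟩
  p * φ m ∸ 1 * φ m       ≡⟨ sym (*-distribʳ-∸ (φ m) p 1) ⟩
  (p ∸ 1) * φ m           ∎
  where open ≡-Reasoning

φ-prime : ∀ {p} → Prime p → φ p ≡ p ∸ 1
φ-prime {p} p-prime = begin
  φ p           ≡⟨ cong φ (sym (*-identityʳ p)) ⟩
  φ (p * 1)     ≡⟨ φ-*-∤ p-prime (prime∤1 p-prime) ⟩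
  (p ∸ 1) * 1   ≡⟨ *-identityʳ (p ∸ 1) ⟩
  p ∸ 1         ∎
  where open ≡-Reasoning

φ∣φ[p*m] : ∀ {p} m → Prime p → φ m ∣ φ (p * m)
φ∣φ[p*m] {p} m p-prime with p ∣? m
... | yes p∣m = subst (φ m ∣_) (sym (φ-*-∣ p m p∣m)) (n∣m*n p)
... | no  p∤m = subst (φ m ∣_) (sym (φ-*-∤ p-prime p∤m)) (n∣m*n (p ∸ 1))

2∣φ : ∀ n → 2 < n → 2 ∣ φ n
2∣φ = <-rec (λ n → 2 < n → 2 ∣ φ n) step
  where
  step : ∀ n → (∀ {m} → m < n → 2 < m → 2 ∣ φ m) → 2 < n → 2 ∣ φ n
  step n rec 2<n with prime-factor n (<-trans (s≤s (s≤s z≤n)) 2<n)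
  ... | p , m , p-prime , refl = cases (p ∣? m) (2 ∣? p)
    where
    instance
      _ = prime⇒nonZero p-prime
      _ = m*n≢0⇒n≢0 p {{>-nonZero (<-trans (s≤s z≤n) 2<n)}}
    from-m : 2 < m → 2 ∣ φ (p * m)
    from-m 2<m = ∣-trans (rec (subst (m <_) (*-comm m p) (m<m*n m p (prime⇒1<p p-prime))) 2<m)
                         (φ∣φ[p*m] m p-prime)
    cases : Dec (p ∣ m) → Dec (2 ∣ p) → 2 ∣ φ (p * m)
    cases (yes p∣m) (yes 2∣p) = subst (2 ∣_) (sym (φ-*-∣ p m p∣m)) (∣m⇒∣m*n (φ m) 2∣p)
    cases (no p∤m)  (no 2∤p)  = subst (2 ∣_) (sym (φ-*-∤ p-prime p∤m)) (∣m⇒∣m*n (φ m) (2∤n⇒2∣n∸1 2∤p))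
    cases (yes p∣m) (no 2∤p)  = from-m (≤-trans (prime∧2∤⇒2<p p-prime 2∤p) (∣⇒≤ p∣m))
    cases (no p∤m)  (yes 2∣p) = from-m (2∤n∧n≢1⇒2<n 2∤m m≢1)
      where
      p≡2 : p ≡ 2
      p≡2 = prime∧2∣⇒≡2 p-prime 2∣p
      2∤m : ¬ 2 ∣ m
      2∤m 2∣m = p∤m (subst (_∣ m) (sym p≡2) 2∣m)
      m≢1 : m ≢ 1
      m≢1 m≡1 = <⇒≢ 2<n (sym (cong₂ _*_ p≡2 m≡1))

-- The height H and Shapiro's function C

Hfuel-irrelevant : ∀ {f g} n → n ≤ f → n ≤ g → Hfuel f n ≡ Hfuel g n
Hfuel-irrelevant {zero}  {zero}  _ _   _   = refl
Hfuel-irrelevant {zero}  {suc _} _ z≤n _   = refl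
Hfuel-irrelevant {suc _} {zero}  _ _   z≤n = refl
Hfuel-irrelevant {suc f} {suc g} n n≤1+f n≤1+g with n ≤? 1
... | yes _   = refl
... | no  n≰1 = cong suc (Hfuel-irrelevant (φ n) (φ[n]≤ n≤1+f) (φ[n]≤ n≤1+g))
  where
  φ[n]≤ : ∀ {k} → n ≤ suc k → φ n ≤ k
  φ[n]≤ n≤1+k = s≤s⁻¹ (<-≤-trans (φ<n (≰⇒> n≰1)) n≤1+k)

H-φ : ∀ {n} → 1 < n → H n ≡ suc (H (φ n))
H-φ {suc m} 1<n with suc m ≤? 1
... | yes n≤1 = contradiction n≤1 (<⇒≱ 1<n)
... | no  _   = cong suc (Hfuel-irrelevant (φ (suc m)) (s≤s⁻¹ (φ<n 1<n)) ≤-refl)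

C : ℕ → ℕ
C n with 2 ∣? n
... | yes _ = H n
... | no  _ = H n ∸ 1

C-even : ∀ {n} → 2 ∣ n → C n ≡ H n
C-even {n} 2∣n with 2 ∣? n
... | yes _   = refl
... | no  2∤n = contradiction 2∣n 2∤n

C-odd : ∀ {n} → ¬ 2 ∣ n → C n ≡ H n ∸ 1
C-odd {n} 2∤n with 2 ∣? n
... | yes 2∣n = contradiction 2∣n 2∤n
... | no  _   = refl

C≤H : ∀ n → C n ≤ H n
C≤H n with 2 ∣? n
... | yes _ = ≤-refl
... | no  _ = m∸n≤m (H n) 1

C[φ]≡H[φ] : ∀ {n} → 1 < n → C (φ n) ≡ H (φ n)
C[φ]≡H[φ] {1}                   (s≤s ())
C[φ]≡H[φ] {2}                   _ = refl
C[φ]≡H[φ] {n@(suc (suc (suc _)))} _ = C-even (2∣φ n (s≤s (s≤s (s≤s z≤n))))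

C-φ : ∀ {n} → 1 < n → C n ≡ C (φ n) + 𝟙 (2 ∣? n)
C-φ {n} 1<n with 2 ∣? n
... | yes _ = begin
  H n             ≡⟨ H-φ 1<n ⟩
  suc (H (φ n))   ≡⟨ cong suc (sym (C[φ]≡H[φ] 1<n)) ⟩
  suc (C (φ n))   ≡⟨ +-comm 1 (C (φ n)) ⟩
  C (φ n) + 1     ∎
  where open ≡-Reasoning
... | no  _ = begin
  H n ∸ 1         ≡⟨ cong (_∸ 1) (H-φ 1<n) ⟩
  H (φ n)         ≡⟨ sym (C[φ]≡H[φ] 1<n) ⟩
  C (φ n)         ≡⟨ sym (+-identityʳ (C (φ n))) ⟩
  C (φ n) + 0     ∎
  where open ≡-Reasoning

C-prime : ∀ {p} → Prime p → C p ≡ C (p ∸ 1) + 𝟙 (2 ∣? p)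
C-prime {p} p-prime = trans (C-φ (prime⇒1<p p-prime)) (cong (λ k → C k + 𝟙 (2 ∣? p)) (φ-prime p-prime))

C-odd-prime : ∀ {p} → Prime p → ¬ 2 ∣ p → C p ≡ C (p ∸ 1)
C-odd-prime {p} p-prime 2∤p = begin
  C p                      ≡⟨ C-prime p-prime ⟩
  C (p ∸ 1) + 𝟙 (2 ∣? p)   ≡⟨ cong (C (p ∸ 1) +_) (𝟙-no (2 ∣? p) 2∤p) ⟩
  C (p ∸ 1) + 0            ≡⟨ +-identityʳ (C (p ∸ 1)) ⟩
  C (p ∸ 1)                ∎
  where open ≡-Reasoning

n∸1-nonZero : ∀ {n} → 1 < n → NonZero (n ∸ 1)
n∸1-nonZero (s≤s (s≤s _)) = _

n∸1<n : ∀ {n} → 1 < n → n ∸ 1 < n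
n∸1<n {suc n} _ = n<1+n n

-- Additivity for the smaller first factor p - 1 is needed because φ(p m) = (p - 1) φ(m)
-- when p ∤ m; the case p ∣ m recurses on φ(m) < m instead.
C-*-prime : ∀ {p} → Prime p →
            (∀ {a} → .{{NonZero a}} → a < p → ∀ b .{{_ : NonZero b}} → C (a * b) ≡ C a + C b) →
            ∀ m .{{_ : NonZero m}} → C (p * m) ≡ C p + C m
C-*-prime {p} p-prime C-*-below = <-rec (λ m → .{{NonZero m}} → C (p * m) ≡ C p + C m) step
  where
  step : ∀ m → (∀ {k} → k < m → .{{NonZero k}} → C (p * k) ≡ C p + C k) →
         .{{NonZero m}} → C (p * m) ≡ C p + C m
  step 1               _   = trans (cong C (*-identityʳ p)) (sym (+-identityʳ (C p)))
  step m@(suc (suc _)) rec = begin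
    C (p * m)                          ≡⟨ C-φ (<-≤-trans 1<m (m≤n*m m p)) ⟩
    C (φ (p * m)) + 𝟙 (2 ∣? (p * m))   ≡⟨ cases (p ∣? m) ⟩
    C p + (C (φ m) + 𝟙 (2 ∣? m))       ≡⟨ cong (C p +_) (sym (C-φ 1<m)) ⟩
    C p + C m                          ∎
    where
    open ≡-Reasoning
    instance
      _ = prime⇒nonZero p-prime
      _ = φ-nonZero m
      _ = n∸1-nonZero (prime⇒1<p p-prime)
    1<m : 1 < m
    1<m = s≤s (s≤s z≤n)
    cases : Dec (p ∣ m) → C (φ (p * m)) + 𝟙 (2 ∣? (p * m)) ≡ C p + (C (φ m) + 𝟙 (2 ∣? m))
    cases (yes p∣m) = begin
      C (φ (p * m)) + 𝟙 (2 ∣? (p * m))   ≡⟨ cong₂ _+_ (cong C (φ-*-∣ p m p∣m)) (𝟙-2∣-*-∣ p∣m) ⟩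
      C (p * φ m) + 𝟙 (2 ∣? m)           ≡⟨ cong (_+ 𝟙 (2 ∣? m)) (rec (φ<n 1<m)) ⟩
      C p + C (φ m) + 𝟙 (2 ∣? m)         ≡⟨ +-assoc (C p) (C (φ m)) _ ⟩
      C p + (C (φ m) + 𝟙 (2 ∣? m))       ∎
    cases (no p∤m) = begin
      C (φ (p * m)) + 𝟙 (2 ∣? (p * m))
        ≡⟨ cong₂ _+_ (cong C (φ-*-∤ p-prime p∤m)) (𝟙-2∣-* 2∤m) ⟩
      C ((p ∸ 1) * φ m) + (𝟙 (2 ∣? p) + 𝟙 (2 ∣? m))
        ≡⟨ cong (_+ (𝟙 (2 ∣? p) + 𝟙 (2 ∣? m))) (C-*-below (n∸1<n (prime⇒1<p p-prime)) (φ m)) ⟩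
      C (p ∸ 1) + C (φ m) + (𝟙 (2 ∣? p) + 𝟙 (2 ∣? m))
        ≡⟨ interchange (C (p ∸ 1)) (C (φ m)) _ _ ⟩
      C (p ∸ 1) + 𝟙 (2 ∣? p) + (C (φ m) + 𝟙 (2 ∣? m))
        ≡⟨ cong (_+ (C (φ m) + 𝟙 (2 ∣? m))) (sym (C-prime p-prime)) ⟩
      C p + (C (φ m) + 𝟙 (2 ∣? m))
        ∎
      where
      2∤m : 2 ∣ p → ¬ 2 ∣ m
      2∤m 2∣p 2∣m = p∤m (subst (_∣ m) (sym (prime∧2∣⇒≡2 p-prime 2∣p)) 2∣m)

C-* : ∀ a .{{_ : NonZero a}} b .{{_ : NonZero b}} → C (a * b) ≡ C a + C b
C-* = prime-induction {P = λ a → ∀ b .{{_ : NonZero b}} → C (a * b) ≡ C a + C b}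
        (λ b → cong C (*-identityˡ b)) C-*-prime C-*-closed
  where
  C-*-closed : ∀ {a b} .{{_ : NonZero a}} .{{_ : NonZero b}} →
               (∀ c .{{_ : NonZero c}} → C (a * c) ≡ C a + C c) →
               (∀ c .{{_ : NonZero c}} → C (b * c) ≡ C b + C c) →
               ∀ c .{{_ : NonZero c}} → C (a * b * c) ≡ C (a * b) + C c
  C-*-closed {a} {b} C-a* C-b* c = begin
    C (a * b * c)       ≡⟨ cong C (*-assoc a b c) ⟩
    C (a * (b * c))     ≡⟨ C-a* (b * c) {{m*n≢0 b c}} ⟩
    C a + C (b * c)     ≡⟨ cong (C a +_) (C-b* c) ⟩
    C a + (C b + C c)   ≡⟨ sym (+-assoc (C a) (C b) (C c)) ⟩
    C a + C b + C c     ≡⟨ cong (_+ C c) (sym (C-a* b)) ⟩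
    C (a * b) + C c     ∎
    where open ≡-Reasoning

-- Bounds on C, H and S

^-cancelʳ-≤ : ∀ m {a b} → 1 < m → m ^ a ≤ m ^ b → a ≤ b
^-cancelʳ-≤ m 1<m mᵃ≤mᵇ = ≮⇒≥ (λ b<a → <⇒≱ (^-monoʳ-< m 1<m b<a) mᵃ≤mᵇ)

^-cancelʳ-< : ∀ m .{{_ : NonZero m}} {a b} → m ^ a < m ^ b → a < b
^-cancelʳ-< m mᵃ<mᵇ = ≰⇒> (λ b≤a → <⇒≱ mᵃ<mᵇ (^-monoʳ-≤ m b≤a))

2^C≤n : ∀ n .{{_ : NonZero n}} → 2 ^ C n ≤ n
2^C≤n = prime-induction {P = λ n → 2 ^ C n ≤ n} ≤-refl prime-case product-case
  where
  prime-case : ∀ {p} → Prime p → (∀ {m} → .{{NonZero m}} → m < p → 2 ^ C m ≤ m) → 2 ^ C p ≤ p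
  prime-case {p} p-prime below = cases (2 ∣? p)
    where
    open ≤-Reasoning
    1<p : 1 < p
    1<p = prime⇒1<p p-prime
    cases : Dec (2 ∣ p) → 2 ^ C p ≤ p
    cases (yes 2∣p) = subst (λ q → 2 ^ C q ≤ q) (sym (prime∧2∣⇒≡2 p-prime 2∣p)) ≤-refl
    cases (no 2∤p)  = begin
      2 ^ C p         ≡⟨ cong (2 ^_) (C-odd-prime p-prime 2∤p) ⟩
      2 ^ C (p ∸ 1)   ≤⟨ below {{n∸1-nonZero 1<p}} (n∸1<n 1<p) ⟩
      p ∸ 1           ≤⟨ m∸n≤m p 1 ⟩
      p               ∎
  product-case : ∀ {a b} .{{_ : NonZero a}} .{{_ : NonZero b}} →
                 2 ^ C a ≤ a → 2 ^ C b ≤ b → 2 ^ C (a * b) ≤ a * b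
  product-case {a} {b} 2^Ca≤a 2^Cb≤b = begin
    2 ^ C (a * b)       ≡⟨ cong (2 ^_) (C-* a b) ⟩
    2 ^ (C a + C b)     ≡⟨ ^-distribˡ-+-* 2 (C a) (C b) ⟩
    2 ^ C a * 2 ^ C b   ≤⟨ *-mono-≤ 2^Ca≤a 2^Cb≤b ⟩
    a * b               ∎
    where open ≤-Reasoning

n≤3^C : ∀ n .{{_ : NonZero n}} → n ≤ 3 ^ C n
n≤3^C = prime-induction {P = λ n → n ≤ 3 ^ C n} (s≤s z≤n) prime-case product-case
  where
  prime-case : ∀ {p} → Prime p → (∀ {m} → .{{NonZero m}} → m < p → m ≤ 3 ^ C m) → p ≤ 3 ^ C p
  prime-case {p} p-prime below = cases (2 ∣? p)
    where
    open ≤-Reasoning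
    1<p : 1 < p
    1<p = prime⇒1<p p-prime
    cases : Dec (2 ∣ p) → p ≤ 3 ^ C p
    cases (yes 2∣p) = subst (λ q → q ≤ 3 ^ C q) (sym (prime∧2∣⇒≡2 p-prime 2∣p)) (s≤s (s≤s z≤n))
    cases (no 2∤p) with 2∤n⇒2∣n∸1 2∤p
    ... | divides q p∸1≡q*2 = begin
      p                       ≡⟨ sym (m+[n∸m]≡n (<⇒≤ 1<p)) ⟩
      suc (p ∸ 1)             ≡⟨ cong suc p∸1≡q*2 ⟩
      suc (q * 2)             ≤⟨ +-mono-≤ (m^n>0 3 (C q)) (*-monoˡ-≤ 2 (below q<p)) ⟩
      3 ^ C q + 3 ^ C q * 2   ≡⟨ sym (*-suc (3 ^ C q) 2) ⟩
      3 ^ C q * 3             ≡⟨ sym (^-distribˡ-+-* 3 (C q) (C 2)) ⟩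
      3 ^ (C q + C 2)         ≡⟨ cong (3 ^_) (sym (C-* q 2)) ⟩
      3 ^ C (q * 2)           ≡⟨ cong (λ k → 3 ^ C k) (sym p∸1≡q*2) ⟩
      3 ^ C (p ∸ 1)           ≡⟨ cong (3 ^_) (sym (C-odd-prime p-prime 2∤p)) ⟩
      3 ^ C p                 ∎
      where
      instance
        _ = m*n≢0⇒m≢0 q {{subst NonZero p∸1≡q*2 (n∸1-nonZero 1<p)}}
      q<p : q < p
      q<p = ≤-<-trans (≤-trans (m≤m*n q 2) (≤-reflexive (sym p∸1≡q*2))) (n∸1<n 1<p)
  product-case : ∀ {a b} .{{_ : NonZero a}} .{{_ : NonZero b}} →
                 a ≤ 3 ^ C a → b ≤ 3 ^ C b → a * b ≤ 3 ^ C (a * b)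
  product-case {a} {b} a≤3^Ca b≤3^Cb = begin
    a * b               ≤⟨ *-mono-≤ a≤3^Ca b≤3^Cb ⟩
    3 ^ C a * 3 ^ C b   ≡⟨ sym (^-distribˡ-+-* 3 (C a) (C b)) ⟩
    3 ^ (C a + C b)     ≡⟨ cong (3 ^_) (sym (C-* a b)) ⟩
    3 ^ C (a * b)       ∎
    where open ≤-Reasoning

n≤3^H : ∀ n .{{_ : NonZero n}} → n ≤ 3 ^ H n
n≤3^H n = ≤-trans (n≤3^C n) (^-monoʳ-≤ 3 (C≤H n))

n≤2^k⇒H[n]≤k : ∀ {n} k .{{_ : NonZero n}} → n ≤ 2 ^ k → H n ≤ k
n≤2^k⇒H[n]≤k {1}               _ _     = z≤n
n≤2^k⇒H[n]≤k {n@(suc (suc _))} k n≤2^k = cases (2 ∣? n)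
  where
  open ≤-Reasoning
  1<n : 1 < n
  1<n = s≤s (s≤s z≤n)
  cases : Dec (2 ∣ n) → H n ≤ k
  cases (yes 2∣n) = ^-cancelʳ-≤ 2 (s≤s (s≤s z≤n)) (begin
    2 ^ H n   ≡⟨ cong (2 ^_) (sym (C-even 2∣n)) ⟩
    2 ^ C n   ≤⟨ 2^C≤n n ⟩
    n         ≤⟨ n≤2^k ⟩
    2 ^ k     ∎)
  cases (no 2∤n)  = subst (_≤ k) (sym (H-φ 1<n)) (^-cancelʳ-< 2 (begin-strict
    2 ^ H (φ n)   ≡⟨ cong (2 ^_) (sym (trans (C-odd 2∤n) (cong (_∸ 1) (H-φ 1<n)))) ⟩
    2 ^ C n       ≤⟨ 2^C≤n n ⟩
    n             <⟨ n<2^k ⟩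
    2 ^ k         ∎))
    where
    n<2^k : n < 2 ^ k
    n<2^k with m≤n⇒m<n∨m≡n n≤2^k
    ... | inj₁ n<2^k = n<2^k
    ... | inj₂ n≡2^k = contradiction (trans n≡2^k (2∤2^k⇒2^k≡1 k (subst (λ m → ¬ 2 ∣ m) n≡2^k 2∤n)))
                                     (<⇒≢ 1<n ∘′ sym)

n≤x*[1+n∸x] : ∀ {n x} → 1 ≤ x → x ≤ n → n ≤ x * (suc n ∸ x)
n≤x*[1+n∸x] {n} {x} 1≤x x≤n = begin
  n                 ≡⟨ sym (m+[n∸m]≡n x≤n) ⟩
  x + (n ∸ x)       ≤⟨ +-monoʳ-≤ x (m≤n*m (n ∸ x) x {{>-nonZero 1≤x}}) ⟩
  x + x * (n ∸ x)   ≡⟨ sym (*-suc x (n ∸ x)) ⟩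
  x * suc (n ∸ x)   ≡⟨ cong (x *_) (sym (+-∸-assoc 1 x≤n)) ⟩
  x * (suc n ∸ x)   ∎
  where open ≤-Reasoning

S-∑ : ∀ n → S n ≡ ∑ n H
S-∑ = sum-map-range1 H

n^n≤9^S : ∀ n → n ^ n ≤ 9 ^ S n
n^n≤9^S n = begin
  n ^ n                                 ≤⟨ ∑-power 3 n pair-bound ⟩
  3 ^ ∑ n (λ x → H x + H (suc n ∸ x))   ≡⟨ cong (3 ^_) pair-sum ⟩
  3 ^ (2 * S n)                         ≡⟨ sym (^-*-assoc 3 2 (S n)) ⟩
  9 ^ S n                               ∎
  where
  open ≤-Reasoning
  pair-bound : ∀ {x} → 1 ≤ x → x ≤ n → n ≤ 3 ^ (H x + H (suc n ∸ x))
  pair-bound {x} 1≤x x≤n = begin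
    n                             ≤⟨ n≤x*[1+n∸x] 1≤x x≤n ⟩
    x * (suc n ∸ x)               ≤⟨ *-mono-≤ (n≤3^H x {{>-nonZero 1≤x}})
                                              (n≤3^H (suc n ∸ x) {{>-nonZero (m<n⇒0<n∸m (s≤s x≤n))}}) ⟩
    3 ^ H x * 3 ^ H (suc n ∸ x)   ≡⟨ sym (^-distribˡ-+-* 3 (H x) _) ⟩
    3 ^ (H x + H (suc n ∸ x))     ∎
  pair-sum : ∑ n (λ x → H x + H (suc n ∸ x)) ≡ 2 * S n
  pair-sum = begin-equality
    ∑ n (λ x → H x + H (suc n ∸ x))     ≡⟨ ∑-distrib-+ n ⟩
    ∑ n H + ∑ n (λ x → H (suc n ∸ x))   ≡⟨ cong (∑ n H +_) (sym (∑-reverse n)) ⟩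
    ∑ n H + ∑ n H                       ≡⟨ cong (λ s → s + s) (sym (S-∑ n)) ⟩
    S n + S n                           ≡⟨ cong (S n +_) (sym (+-identityʳ (S n))) ⟩
    2 * S n                             ∎

2^[k∸1]≤n : ∀ {n} k .{{_ : NonZero n}} → 2 ^ k < 2 * n → 2 ^ (k ∸ 1) ≤ n
2^[k∸1]≤n {suc _} zero    _      = s≤s z≤n
2^[k∸1]≤n {n}     (suc k) 2^k<2n = <⇒≤ (*-cancelˡ-< 2 (2 ^ k) n 2^k<2n)

lemma4p2 : (n k : ℕ) → .{{_ : NonZero n}} → 2 ^ k < 2 * n → n ≤ 2 ^ k →
    (2 ^ ((k ∸ 2) * n) ≤ 9 ^ S n) × (S n ≤ k * n)
lemma4p2 n k 2^k<2n n≤2^k = lower , upper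
  where
  open ≤-Reasoning
  lower : 2 ^ ((k ∸ 2) * n) ≤ 9 ^ S n
  lower = begin
    2 ^ ((k ∸ 2) * n)   ≡⟨ sym (^-*-assoc 2 (k ∸ 2) n) ⟩
    (2 ^ (k ∸ 2)) ^ n   ≤⟨ ^-monoˡ-≤ n (^-monoʳ-≤ 2 (∸-monoʳ-≤ k (s≤s z≤n))) ⟩
    (2 ^ (k ∸ 1)) ^ n   ≤⟨ ^-monoˡ-≤ n (2^[k∸1]≤n k 2^k<2n) ⟩
    n ^ n               ≤⟨ n^n≤9^S n ⟩
    9 ^ S n             ∎
  upper : S n ≤ k * n
  upper = begin
    S n     ≡⟨ S-∑ n ⟩
    ∑ n H   ≤⟨ ∑-≤ n (λ 1≤x x≤n → n≤2^k⇒H[n]≤k k {{>-nonZero 1≤x}} (≤-trans x≤n n≤2^k)) ⟩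
    n * k   ≡⟨ *-comm n k ⟩
    k * n   ∎
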